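{- The only uniform topological operators in $H[\mathsf x]$ are $\mathsf x$, $\neg\neg\mathsf x$ and $1$. Consequently, besides $\mathcal K$ itself and the degenerate topos, $\mathcal K$ has exactly one subtopos, namely the subtopos $\mathcal K_{\neg\neg}\hookrightarrow\mathcal K$ of $\neg\neg$-sheaves.
   Context: $H[\mathsf x]$ is the free Heyting algebra on one generator $\mathsf x$ (the Rieger–Nishimura lattice), and $H[\mathsf x,\mathsf y]$ the free Heyting algebra on two generators. A uniform topological operator is an element $\varphi(\mathsf x)\in H[\mathsf x]$ such that $\varphi(1)=1$ in $H[\mathsf x]$, $\varphi(\mathsf x\wedge\mathsf y)=\varphi(\mathsf x)\wedge\varphi(\mathsf y)$ in $H[\mathsf x,\mathsf y]$, and $\varphi(\varphi(\mathsf x))=\varphi(\mathsf x)$ in $H[\mathsf x]$. $\mathcal K=\mathbf{Sh}(\mathbf{Kp},J)$, where $\mathbf{Kp}$ is the category of finite posets and open maps (monotone $f$ with: $f(p)\le q$ implies $\exists p'\ge p$, $f(p')=q$) and $J$ is the topology of jointly surjective sieves. Subtopoi of $\mathcal K$ correspond bijectively to uniform topological operators (via $\mathcal K(\Omega,\Omega)\cong H[\mathsf x]$ and Lawvere–Tierney topologies). -}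

module Defs where

open import Level using (0ℓ)
open import Data.Nat using (ℕ)
open import Data.Fin using (Fin; zero; suc)
open import Relation.Binary.Lattice.Bundles using (HeytingAlgebra)

infixr 7 _∧ᶠ_
infixr 6 _∨ᶠ_
infixr 5 _⇒ᶠ_
data Fm (n : ℕ) : Set where
  var   : Fin n → Fm n
  ⊤ᶠ ⊥ᶠ : Fm n
  _∧ᶠ_ _∨ᶠ_ _⇒ᶠ_ : Fm n → Fm n → Fm n

¬ᶠ_ : ∀ {n} → Fm n → Fm n
¬ᶠ φ = φ ⇒ᶠ ⊥ᶠ

subst : ∀ {m n} → Fm m → (Fin m → Fm n) → Fm n
subst (var i)    σ = σ i
subst ⊤ᶠ         σ = ⊤ᶠ
subst ⊥ᶠ         σ = ⊥ᶠ
subst (φ ∧ᶠ ψ)   σ = subst φ σ ∧ᶠ subst ψ σ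
subst (φ ∨ᶠ ψ)   σ = subst φ σ ∨ᶠ subst ψ σ
subst (φ ⇒ᶠ ψ)   σ = subst φ σ ⇒ᶠ subst ψ σ

⟦_⟧ : ∀ {n} → Fm n → (H : HeytingAlgebra 0ℓ 0ℓ 0ℓ) →
      (Fin n → HeytingAlgebra.Carrier H) → HeytingAlgebra.Carrier H
⟦ var i ⟧  H v = v i
⟦ ⊤ᶠ ⟧     H v = HeytingAlgebra.⊤ H
⟦ ⊥ᶠ ⟧     H v = HeytingAlgebra.⊥ H
⟦ φ ∧ᶠ ψ ⟧ H v = HeytingAlgebra._∧_ H (⟦ φ ⟧ H v) (⟦ ψ ⟧ H v)
⟦ φ ∨ᶠ ψ ⟧ H v = HeytingAlgebra._∨_ H (⟦ φ ⟧ H v) (⟦ ψ ⟧ H v)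
⟦ φ ⇒ᶠ ψ ⟧ H v = HeytingAlgebra._⇨_ H (⟦ φ ⟧ H v) (⟦ ψ ⟧ H v)

-- Equality in the free Heyting algebra H[x₁..xₙ]: two terms denote the same
-- element iff they agree in every Heyting algebra under every valuation.
infix 4 _≈ᶠ_
_≈ᶠ_ : ∀ {n} → Fm n → Fm n → Set₁
φ ≈ᶠ ψ = ∀ (H : HeytingAlgebra 0ℓ 0ℓ 0ℓ) (v : Fin _ → HeytingAlgebra.Carrier H) →
         HeytingAlgebra._≈_ H (⟦ φ ⟧ H v) (⟦ ψ ⟧ H v)

𝕩 : Fm 1
𝕩 = var zero

𝕩₂ 𝕪₂ : Fm 2
𝕩₂ = var zero
𝕪₂ = var (suc zero)

_⟨_⟩ : ∀ {n} → Fm 1 → Fm n → Fm n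
φ ⟨ t ⟩ = subst φ (λ _ → t)

record IsUniformTopOp (φ : Fm 1) : Set₁ where
  field
    pres-⊤   : φ ⟨ ⊤ᶠ {1} ⟩ ≈ᶠ ⊤ᶠ
    pres-∧   : φ ⟨ 𝕩₂ ∧ᶠ 𝕪₂ ⟩ ≈ᶠ (φ ⟨ 𝕩₂ ⟩ ∧ᶠ φ ⟨ 𝕪₂ ⟩)
    idem     : φ ⟨ φ ⟩ ≈ᶠ φ

{-# OPTIONS --safe #-}
-- Evaluate a unary term φ on the three-element chain bot < mid < top. If a ≤ u and u ∧ ¬a = ⊥ in
-- a Heyting algebra H, then embed u a (bot ↦ ⊥, mid ↦ a, top ↦ u) is a Heyting homomorphism into
-- the relative algebra ↓u (with x ⇨ᵤ y = u ∧ (x ⇨ y)), and so is u ∧ − : H → ↓u; hence u ∧ φ(a)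
-- is the image of φ(mid). Let φ preserve ⊤ and ∧, hence be monotone. With (u, a) = (⊤, ⊤): if
-- φ(bot) ≠ bot then φ(⊥) = ⊤, so φ is constantly ⊤, while φ(bot) = φ(mid) = bot would force ⊤ = ⊥.
-- Otherwise (u, a) = (a, a) shows that φ is inflationary, so φ(a) ∧ ¬a ≤ φ(a ∧ ¬a) = φ(⊥) = ⊥,
-- i.e. φ(a) ≤ ¬¬a; and (u, a) = (¬¬a, a) gives φ(a) = ¬¬a ∧ φ(a) = a or ¬¬a according as
-- φ(mid) = mid or top. Idempotence is needed only for the converse.
module Submission where

open import Data.Empty using (⊥-elim)
open import Data.Fin using (Fin; zero; suc)
open import Data.Product using (_×_; _,_)
open import Data.Sum using (_⊎_; inj₁; inj₂)
open import Level using (Level; 0ℓ; _⊔_)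
open import Relation.Binary.PropositionalEquality using (_≡_; _≢_; refl; cong₂)
open import Relation.Binary.Lattice.Bundles using (HeytingAlgebra)
import Relation.Binary.Reasoning.PartialOrder as ≤-Reasoning
import Relation.Binary.Reasoning.Setoid as ≈-Reasoning

open import Defs

private variable
  c ℓ₁ ℓ₂ : Level

record IsTopologicalOperator (H : HeytingAlgebra c ℓ₁ ℓ₂)
    (j : HeytingAlgebra.Carrier H → HeytingAlgebra.Carrier H) : Set (c ⊔ ℓ₁) where
  open HeytingAlgebra H using (_≈_; ⊤; _∧_)
  field
    cong   : ∀ {a b} → a ≈ b → j a ≈ j b
    pres-⊤ : j ⊤ ≈ ⊤
    pres-∧ : ∀ a b → j (a ∧ b) ≈ j a ∧ j b
    idem   : ∀ a → j (j a) ≈ j a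

data Three : Set where
  bot mid top : Three

infixr 7 _∧₃_
infixr 6 _∨₃_
infixr 5 _⇨₃_

_∧₃_ : Three → Three → Three
bot ∧₃ _   = bot
mid ∧₃ bot = bot
mid ∧₃ _   = mid
top ∧₃ t   = t

_∨₃_ : Three → Three → Three
bot ∨₃ t   = t
mid ∨₃ top = top
mid ∨₃ _   = mid
top ∨₃ _   = top

_⇨₃_ : Three → Three → Three
bot ⇨₃ _   = top
mid ⇨₃ bot = bot
mid ⇨₃ _   = top
top ⇨₃ t   = t

⟦_⟧₃ : ∀ {n} → Fm n → (Fin n → Three) → Three
⟦ var i ⟧₃  w = w i
⟦ ⊤ᶠ ⟧₃     w = top
⟦ ⊥ᶠ ⟧₃     w = bot
⟦ p ∧ᶠ q ⟧₃ w = ⟦ p ⟧₃ w ∧₃ ⟦ q ⟧₃ w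
⟦ p ∨ᶠ q ⟧₃ w = ⟦ p ⟧₃ w ∨₃ ⟦ q ⟧₃ w
⟦ p ⇒ᶠ q ⟧₃ w = ⟦ p ⟧₃ w ⇨₃ ⟦ q ⟧₃ w

module HeytingAlgebraProperties (H : HeytingAlgebra c ℓ₁ ℓ₂) where
  open HeytingAlgebra H renaming (refl to ≤-refl)
  open import Relation.Binary.Lattice.Properties.HeytingAlgebra H
    using (¬_; x≤¬¬x; ⇨-eval; ⇨-app; ⇨-cong; ⇨-curry; ⇨-applyʳ; ⇨ˡ-contravariant)
  open import Relation.Binary.Lattice.Properties.MeetSemilattice meetSemilattice
    using (∧-comm; ∧-assoc; ∧-cong; ∧-monotonic; ∧-idempotent; y≤x⇒x∧y≈y)
  open import Relation.Binary.Lattice.Properties.JoinSemilattice joinSemilattice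
    using (∨-comm; ∨-idempotent; x≤y⇒x∨y≈y)

  x≤y⇒x∧y≈x : ∀ {x y} → x ≤ y → x ∧ y ≈ x
  x≤y⇒x∧y≈x x≤y = Eq.trans (∧-comm _ _) (y≤x⇒x∧y≈y x≤y)

  x∧y≈x⇒x≤y : ∀ {x y} → x ∧ y ≈ x → x ≤ y
  x∧y≈x⇒x≤y x∧y≈x = trans (reflexive (Eq.sym x∧y≈x)) (x∧y≤y _ _)

  y≤x⇒x∨y≈x : ∀ {x y} → y ≤ x → x ∨ y ≈ x
  y≤x⇒x∨y≈x y≤x = Eq.trans (∨-comm _ _) (x≤y⇒x∨y≈y y≤x)

  x≤y⇒z∧[x⇨y]≈z : ∀ {x y z} → x ≤ y → z ∧ (x ⇨ y) ≈ z
  x≤y⇒z∧[x⇨y]≈z x≤y = x≤y⇒x∧y≈x (transpose-⇨ (trans (x∧y≤y _ _) x≤y))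

  y≤x⇒x∧[x⇨y]≈y : ∀ {x y} → y ≤ x → x ∧ (x ⇨ y) ≈ y
  y≤x⇒x∧[x⇨y]≈y y≤x = Eq.trans (∧-comm _ _) (Eq.trans ⇨-app (x≤y⇒x∧y≈x y≤x))

  x∧¬x≤⊥ : ∀ {x} → x ∧ ¬ x ≤ ⊥
  x∧¬x≤⊥ = ⇨-applyʳ ≤-refl

  ⊤≈⊥⇒x≈⊤ : ⊤ ≈ ⊥ → ∀ x → x ≈ ⊤
  ⊤≈⊥⇒x≈⊤ ⊤≈⊥ x = antisym (maximum x) (trans (reflexive ⊤≈⊥) (minimum x))

  ∧-distribˡ-∧ : ∀ x y z → x ∧ (y ∧ z) ≈ (x ∧ y) ∧ (x ∧ z)
  ∧-distribˡ-∧ x y z = antisym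
    (∧-greatest (∧-monotonic ≤-refl (x∧y≤x _ _)) (∧-monotonic ≤-refl (x∧y≤y _ _)))
    (∧-greatest (trans (x∧y≤x _ _) (x∧y≤x _ _)) (∧-monotonic (x∧y≤y _ _) (x∧y≤y _ _)))

  x∧[y⇨z]≈x∧[x∧y⇨x∧z] : ∀ x y z → x ∧ (y ⇨ z) ≈ x ∧ (x ∧ y ⇨ x ∧ z)
  x∧[y⇨z]≈x∧[x∧y⇨x∧z] x y z = antisym
    (∧-greatest (x∧y≤x _ _) (transpose-⇨ (∧-greatest
      (trans (x∧y≤y _ _) (x∧y≤x _ _))
      (trans (∧-monotonic (x∧y≤y _ _) (x∧y≤y _ _)) ⇨-eval))))
    (∧-greatest (x∧y≤x _ _) (transpose-⇨ (trans
      (∧-greatest (trans (x∧y≤x _ _) (x∧y≤y _ _))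
                  (∧-monotonic (x∧y≤x _ _) ≤-refl))
      (trans ⇨-eval (x∧y≤y _ _)))))

  ¬¬-monotone : ∀ {x y} → x ≤ y → ¬ ¬ x ≤ ¬ ¬ y
  ¬¬-monotone x≤y = ⇨ˡ-contravariant (⇨ˡ-contravariant x≤y)

  ¬¬-pres-∧ : ∀ x y → ¬ ¬ (x ∧ y) ≈ ¬ ¬ x ∧ ¬ ¬ y
  ¬¬-pres-∧ x y = antisym
    (∧-greatest (¬¬-monotone (x∧y≤x _ _)) (¬¬-monotone (x∧y≤y _ _)))
    (transpose-⇨ (begin
      (¬ ¬ x ∧ ¬ ¬ y) ∧ ¬ (x ∧ y)  ≈⟨ ∧-assoc _ _ _ ⟩
      ¬ ¬ x ∧ (¬ ¬ y ∧ ¬ (x ∧ y))  ≤⟨ ∧-monotonic ≤-refl ¬¬y∧¬[x∧y]≤¬x ⟩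
      ¬ ¬ x ∧ ¬ x                  ≤⟨ ⇨-eval ⟩
      ⊥                            ∎))
    where
    open ≤-Reasoning poset
    ¬¬y∧¬[x∧y]≤¬x : ¬ ¬ y ∧ ¬ (x ∧ y) ≤ ¬ x
    ¬¬y∧¬[x∧y]≤¬x = transpose-⇨ (begin
      (¬ ¬ y ∧ ¬ (x ∧ y)) ∧ x  ≈⟨ ∧-assoc _ _ _ ⟩
      ¬ ¬ y ∧ (¬ (x ∧ y) ∧ x)  ≤⟨ ∧-monotonic ≤-refl (∧-monotonic (reflexive ⇨-curry) ≤-refl) ⟩
      ¬ ¬ y ∧ ((x ⇨ ¬ y) ∧ x)  ≤⟨ ∧-monotonic ≤-refl ⇨-eval ⟩
      ¬ ¬ y ∧ ¬ y              ≤⟨ ⇨-eval ⟩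
      ⊥                        ∎)

  id-isTopologicalOperator : IsTopologicalOperator H (λ x → x)
  id-isTopologicalOperator = record
    { cong = λ x≈y → x≈y ; pres-⊤ = Eq.refl ; pres-∧ = λ _ _ → Eq.refl ; idem = λ _ → Eq.refl }

  ¬¬-isTopologicalOperator : IsTopologicalOperator H (λ x → ¬ ¬ x)
  ¬¬-isTopologicalOperator = record
    { cong   = λ x≈y → ⇨-cong (⇨-cong x≈y Eq.refl) Eq.refl
    ; pres-⊤ = antisym (maximum _) (x≤¬¬x ⊤)
    ; pres-∧ = ¬¬-pres-∧
    ; idem   = λ x → antisym (⇨ˡ-contravariant (x≤¬¬x (¬ x))) (x≤¬¬x (¬ ¬ x))
    }

  const-⊤-isTopologicalOperator : IsTopologicalOperator H (λ _ → ⊤)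
  const-⊤-isTopologicalOperator = record
    { cong = λ _ → Eq.refl ; pres-⊤ = Eq.refl
    ; pres-∧ = λ _ _ → Eq.sym (∧-idempotent ⊤) ; idem = λ _ → Eq.refl }

  isTopologicalOperator-resp-≈ : ∀ {f g} → (∀ x → f x ≈ g x) →
                                 IsTopologicalOperator H g → IsTopologicalOperator H f
  isTopologicalOperator-resp-≈ {f} {g} f≈g isTop = record
    { cong   = λ {x} {y} x≈y → begin f x ≈⟨ f≈g x ⟩ g x ≈⟨ cong x≈y ⟩ g y ≈⟨ Eq.sym (f≈g y) ⟩ f y ∎
    ; pres-⊤ = Eq.trans (f≈g ⊤) pres-⊤
    ; pres-∧ = λ x y → begin
        f (x ∧ y)    ≈⟨ f≈g (x ∧ y) ⟩
        g (x ∧ y)    ≈⟨ pres-∧ x y ⟩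
        g x ∧ g y    ≈⟨ ∧-cong (Eq.sym (f≈g x)) (Eq.sym (f≈g y)) ⟩
        f x ∧ f y    ∎
    ; idem   = λ x → begin
        f (f x)  ≈⟨ f≈g (f x) ⟩
        g (f x)  ≈⟨ cong (f≈g x) ⟩
        g (g x)  ≈⟨ idem x ⟩
        g x      ≈⟨ Eq.sym (f≈g x) ⟩
        f x      ∎
    }
    where
    open IsTopologicalOperator isTop
    open ≈-Reasoning setoid

  module _ {j : Carrier → Carrier} (isTop : IsTopologicalOperator H j) where
    open IsTopologicalOperator isTop

    monotone : ∀ {x y} → x ≤ y → j x ≤ j y
    monotone {x} {y} x≤y = begin
      j x        ≈⟨ cong (Eq.sym (x≤y⇒x∧y≈x x≤y)) ⟩
      j (x ∧ y)  ≈⟨ pres-∧ x y ⟩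
      j x ∧ j y  ≤⟨ x∧y≤y _ _ ⟩
      j y        ∎
      where open ≤-Reasoning poset

    j⊥≈⊤⇒jx≈⊤ : j ⊥ ≈ ⊤ → ∀ x → j x ≈ ⊤
    j⊥≈⊤⇒jx≈⊤ j⊥≈⊤ x = antisym (maximum _) (trans (reflexive (Eq.sym j⊥≈⊤)) (monotone (minimum x)))

    inflationary⇒jx≤¬¬x : (∀ x → x ≤ j x) → j ⊥ ≤ ⊥ → ∀ x → j x ≤ ¬ ¬ x
    inflationary⇒jx≤¬¬x x≤jx j⊥≤⊥ x = transpose-⇨ (begin
      j x ∧ ¬ x      ≤⟨ ∧-monotonic ≤-refl (x≤jx (¬ x)) ⟩
      j x ∧ j (¬ x)  ≈⟨ Eq.sym (pres-∧ x (¬ x)) ⟩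
      j (x ∧ ¬ x)    ≤⟨ monotone x∧¬x≤⊥ ⟩
      j ⊥            ≤⟨ j⊥≤⊥ ⟩
      ⊥              ∎)
      where open ≤-Reasoning poset

  embed : Carrier → Carrier → Three → Carrier
  embed u a bot = ⊥
  embed u a mid = a
  embed u a top = u

  embed-diagonal : ∀ {x t} → t ≢ bot → embed x x t ≈ x
  embed-diagonal {t = bot} t≢bot = ⊥-elim (t≢bot refl)
  embed-diagonal {t = mid} _     = Eq.refl
  embed-diagonal {t = top} _     = Eq.refl

  module _ {u a : Carrier} (a≤u : a ≤ u) where

    embed≤u : ∀ t → embed u a t ≤ u
    embed≤u bot = minimum u
    embed≤u mid = a≤u
    embed≤u top = ≤-refl

    embed-∧ : ∀ s t → embed u a s ∧ embed u a t ≈ embed u a (s ∧₃ t)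
    embed-∧ bot t   = x≤y⇒x∧y≈x (minimum _)
    embed-∧ mid bot = y≤x⇒x∧y≈y (minimum a)
    embed-∧ mid mid = ∧-idempotent a
    embed-∧ mid top = x≤y⇒x∧y≈x a≤u
    embed-∧ top t   = y≤x⇒x∧y≈y (embed≤u t)

    embed-∨ : ∀ s t → embed u a s ∨ embed u a t ≈ embed u a (s ∨₃ t)
    embed-∨ bot t   = x≤y⇒x∨y≈y (minimum _)
    embed-∨ mid bot = y≤x⇒x∨y≈x (minimum a)
    embed-∨ mid mid = ∨-idempotent a
    embed-∨ mid top = x≤y⇒x∨y≈y a≤u
    embed-∨ top t   = y≤x⇒x∨y≈x (embed≤u t)

    embed-⇨ : u ∧ ¬ a ≤ ⊥ → ∀ s t → u ∧ (embed u a s ⇨ embed u a t) ≈ embed u a (s ⇨₃ t)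
    embed-⇨ _     bot t   = x≤y⇒z∧[x⇨y]≈z (minimum _)
    embed-⇨ dense mid bot = antisym dense (minimum _)
    embed-⇨ _     mid mid = x≤y⇒z∧[x⇨y]≈z ≤-refl
    embed-⇨ _     mid top = x≤y⇒z∧[x⇨y]≈z a≤u
    embed-⇨ _     top t   = y≤x⇒x∧[x⇨y]≈y (embed≤u t)

⟦_⟧₁ : Fm 1 → (H : HeytingAlgebra 0ℓ 0ℓ 0ℓ) → HeytingAlgebra.Carrier H → HeytingAlgebra.Carrier H
⟦ φ ⟧₁ H a = ⟦ φ ⟧ H (λ _ → a)

module TermSemantics (H : HeytingAlgebra 0ℓ 0ℓ 0ℓ) where
  open HeytingAlgebra H hiding (refl)
  open HeytingAlgebraProperties H
  open import Relation.Binary.Lattice.Properties.HeytingAlgebra H using (¬_; ⇨-cong; ∧-distribˡ-∨)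
  open import Relation.Binary.Lattice.Properties.MeetSemilattice meetSemilattice
    using (∧-cong; y≤x⇒x∧y≈y)
  open import Relation.Binary.Lattice.Properties.JoinSemilattice joinSemilattice using (∨-cong)
  open ≈-Reasoning setoid

  ⟦⟧-subst : ∀ {m n} (p : Fm m) (σ : Fin m → Fm n) v →
             ⟦ subst p σ ⟧ H v ≡ ⟦ p ⟧ H (λ i → ⟦ σ i ⟧ H v)
  ⟦⟧-subst (var i)  σ v = refl
  ⟦⟧-subst ⊤ᶠ       σ v = refl
  ⟦⟧-subst ⊥ᶠ       σ v = refl
  ⟦⟧-subst (p ∧ᶠ q) σ v = cong₂ _∧_ (⟦⟧-subst p σ v) (⟦⟧-subst q σ v)
  ⟦⟧-subst (p ∨ᶠ q) σ v = cong₂ _∨_ (⟦⟧-subst p σ v) (⟦⟧-subst q σ v)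
  ⟦⟧-subst (p ⇒ᶠ q) σ v = cong₂ _⇨_ (⟦⟧-subst p σ v) (⟦⟧-subst q σ v)

  ⟦⟧-cong : ∀ {n} (p : Fm n) {v w : Fin n → Carrier} → (∀ i → v i ≈ w i) → ⟦ p ⟧ H v ≈ ⟦ p ⟧ H w
  ⟦⟧-cong (var i)  v≈w = v≈w i
  ⟦⟧-cong ⊤ᶠ       v≈w = Eq.refl
  ⟦⟧-cong ⊥ᶠ       v≈w = Eq.refl
  ⟦⟧-cong (p ∧ᶠ q) v≈w = ∧-cong (⟦⟧-cong p v≈w) (⟦⟧-cong q v≈w)
  ⟦⟧-cong (p ∨ᶠ q) v≈w = ∨-cong (⟦⟧-cong p v≈w) (⟦⟧-cong q v≈w)
  ⟦⟧-cong (p ⇒ᶠ q) v≈w = ⇨-cong (⟦⟧-cong p v≈w) (⟦⟧-cong q v≈w)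

  ⟦⟧-unary : (φ : Fm 1) (v : Fin 1 → Carrier) → ⟦ φ ⟧ H v ≈ ⟦ φ ⟧₁ H (v zero)
  ⟦⟧-unary φ v = ⟦⟧-cong φ λ { zero → Eq.refl }

  ⟦⟨⟩⟧ : ∀ {n} (φ : Fm 1) (t : Fm n) v → ⟦ φ ⟨ t ⟩ ⟧ H v ≈ ⟦ φ ⟧₁ H (⟦ t ⟧ H v)
  ⟦⟨⟩⟧ φ t v = Eq.reflexive (⟦⟧-subst φ (λ _ → t) v)

  module _ {u a : Carrier} (a≤u : a ≤ u) (dense : u ∧ ¬ a ≤ ⊥) where

    private
      ⟦_⟧ᵉ : ∀ {n} → Fm n → (Fin n → Three) → Carrier
      ⟦ p ⟧ᵉ w = ⟦ p ⟧ H (λ i → embed u a (w i))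

    ⟦⟧-embed : ∀ {n} (p : Fm n) (w : Fin n → Three) → u ∧ ⟦ p ⟧ᵉ w ≈ embed u a (⟦ p ⟧₃ w)
    ⟦⟧-embed (var i)  w = y≤x⇒x∧y≈y (embed≤u a≤u (w i))
    ⟦⟧-embed ⊤ᶠ       w = x≤y⇒x∧y≈x (maximum u)
    ⟦⟧-embed ⊥ᶠ       w = y≤x⇒x∧y≈y (minimum u)
    ⟦⟧-embed (p ∧ᶠ q) w = begin
      u ∧ (⟦ p ⟧ᵉ w ∧ ⟦ q ⟧ᵉ w)                    ≈⟨ ∧-distribˡ-∧ u _ _ ⟩
      (u ∧ ⟦ p ⟧ᵉ w) ∧ (u ∧ ⟦ q ⟧ᵉ w)              ≈⟨ ∧-cong (⟦⟧-embed p w) (⟦⟧-embed q w) ⟩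
      embed u a (⟦ p ⟧₃ w) ∧ embed u a (⟦ q ⟧₃ w)  ≈⟨ embed-∧ a≤u (⟦ p ⟧₃ w) (⟦ q ⟧₃ w) ⟩
      embed u a (⟦ p ∧ᶠ q ⟧₃ w)                    ∎
    ⟦⟧-embed (p ∨ᶠ q) w = begin
      u ∧ (⟦ p ⟧ᵉ w ∨ ⟦ q ⟧ᵉ w)                    ≈⟨ ∧-distribˡ-∨ u _ _ ⟩
      (u ∧ ⟦ p ⟧ᵉ w) ∨ (u ∧ ⟦ q ⟧ᵉ w)              ≈⟨ ∨-cong (⟦⟧-embed p w) (⟦⟧-embed q w) ⟩
      embed u a (⟦ p ⟧₃ w) ∨ embed u a (⟦ q ⟧₃ w)  ≈⟨ embed-∨ a≤u (⟦ p ⟧₃ w) (⟦ q ⟧₃ w) ⟩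
      embed u a (⟦ p ∨ᶠ q ⟧₃ w)                    ∎
    ⟦⟧-embed (p ⇒ᶠ q) w = begin
      u ∧ (⟦ p ⟧ᵉ w ⇨ ⟦ q ⟧ᵉ w)
        ≈⟨ x∧[y⇨z]≈x∧[x∧y⇨x∧z] u _ _ ⟩
      u ∧ (u ∧ ⟦ p ⟧ᵉ w ⇨ u ∧ ⟦ q ⟧ᵉ w)
        ≈⟨ ∧-cong Eq.refl (⇨-cong (⟦⟧-embed p w) (⟦⟧-embed q w)) ⟩
      u ∧ (embed u a (⟦ p ⟧₃ w) ⇨ embed u a (⟦ q ⟧₃ w))
        ≈⟨ embed-⇨ a≤u dense (⟦ p ⟧₃ w) (⟦ q ⟧₃ w) ⟩
      embed u a (⟦ p ⇒ᶠ q ⟧₃ w)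
        ∎

    ⟦⟧₁-embed : (φ : Fm 1) {s t : Three} → ⟦ φ ⟧₃ (λ _ → s) ≡ t →
                u ∧ ⟦ φ ⟧₁ H (embed u a s) ≈ embed u a t
    ⟦⟧₁-embed φ refl = ⟦⟧-embed φ _

  uniformTopOp⇒isTopologicalOperator : ∀ {φ} → IsUniformTopOp φ → IsTopologicalOperator H (⟦ φ ⟧₁ H)
  uniformTopOp⇒isTopologicalOperator {φ} U = record
    { cong   = λ x≈y → ⟦⟧-cong φ (λ _ → x≈y)
    ; pres-⊤ = Eq.trans (Eq.sym (⟦⟨⟩⟧ φ ⊤ᶠ (λ _ → ⊤))) (pres-⊤ H (λ _ → ⊤))
    ; pres-∧ = λ x y → begin
        ⟦ φ ⟧₁ H (x ∧ y)                    ≈⟨ Eq.sym (⟦⟨⟩⟧ φ (𝕩₂ ∧ᶠ 𝕪₂) (pair x y)) ⟩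
        ⟦ φ ⟨ 𝕩₂ ∧ᶠ 𝕪₂ ⟩ ⟧ H (pair x y)        ≈⟨ pres-∧ H (pair x y) ⟩
        ⟦ φ ⟨ 𝕩₂ ⟩ ∧ᶠ φ ⟨ 𝕪₂ ⟩ ⟧ H (pair x y)  ≈⟨ ∧-cong (⟦⟨⟩⟧ φ 𝕩₂ _) (⟦⟨⟩⟧ φ 𝕪₂ _) ⟩
        ⟦ φ ⟧₁ H x ∧ ⟦ φ ⟧₁ H y             ∎
    ; idem   = λ x → Eq.trans (Eq.sym (⟦⟨⟩⟧ φ φ (λ _ → x))) (idem H (λ _ → x))
    }
    where
    open IsUniformTopOp U
    pair : Carrier → Carrier → Fin 2 → Carrier
    pair x y zero       = x
    pair x y (suc zero) = y

  module _ (φ : Fm 1) (isTop : IsTopologicalOperator H (⟦ φ ⟧₁ H)) where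
    open IsTopologicalOperator isTop

    uniform-pres-⊤ : ∀ v → ⟦ φ ⟨ ⊤ᶠ {1} ⟩ ⟧ H v ≈ ⊤
    uniform-pres-⊤ v = Eq.trans (⟦⟨⟩⟧ φ ⊤ᶠ v) pres-⊤

    uniform-pres-∧ : ∀ v → ⟦ φ ⟨ 𝕩₂ ∧ᶠ 𝕪₂ ⟩ ⟧ H v ≈ ⟦ φ ⟨ 𝕩₂ ⟩ ∧ᶠ φ ⟨ 𝕪₂ ⟩ ⟧ H v
    uniform-pres-∧ v = begin
      ⟦ φ ⟨ 𝕩₂ ∧ᶠ 𝕪₂ ⟩ ⟧ H v                        ≈⟨ ⟦⟨⟩⟧ φ (𝕩₂ ∧ᶠ 𝕪₂) v ⟩
      ⟦ φ ⟧₁ H (v zero ∧ v (suc zero))             ≈⟨ pres-∧ _ _ ⟩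
      ⟦ φ ⟧₁ H (v zero) ∧ ⟦ φ ⟧₁ H (v (suc zero))  ≈⟨ Eq.sym (∧-cong (⟦⟨⟩⟧ φ 𝕩₂ v) (⟦⟨⟩⟧ φ 𝕪₂ v)) ⟩
      ⟦ φ ⟨ 𝕩₂ ⟩ ∧ᶠ φ ⟨ 𝕪₂ ⟩ ⟧ H v                  ∎

    uniform-idem : ∀ v → ⟦ φ ⟨ φ ⟩ ⟧ H v ≈ ⟦ φ ⟧ H v
    uniform-idem v = begin
      ⟦ φ ⟨ φ ⟩ ⟧ H v                ≈⟨ ⟦⟨⟩⟧ φ φ v ⟩
      ⟦ φ ⟧₁ H (⟦ φ ⟧ H v)           ≈⟨ cong (⟦⟧-unary φ v) ⟩
      ⟦ φ ⟧₁ H (⟦ φ ⟧₁ H (v zero))   ≈⟨ idem (v zero) ⟩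
      ⟦ φ ⟧₁ H (v zero)              ≈⟨ Eq.sym (⟦⟧-unary φ v) ⟩
      ⟦ φ ⟧ H v                      ∎

  ⟦⟧₁≈⇒⟦⟧≈ : ∀ {φ ψ} → (∀ a → ⟦ φ ⟧₁ H a ≈ ⟦ ψ ⟧₁ H a) → ∀ v → ⟦ φ ⟧ H v ≈ ⟦ ψ ⟧ H v
  ⟦⟧₁≈⇒⟦⟧≈ {φ} {ψ} φ≈ψ v = begin
    ⟦ φ ⟧ H v           ≈⟨ ⟦⟧-unary φ v ⟩
    ⟦ φ ⟧₁ H (v zero)   ≈⟨ φ≈ψ (v zero) ⟩
    ⟦ ψ ⟧₁ H (v zero)   ≈⟨ Eq.sym (⟦⟧-unary ψ v) ⟩
    ⟦ ψ ⟧ H v           ∎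

isTopologicalOperator⇒uniformTopOp : ∀ {φ} → (∀ H → IsTopologicalOperator H (⟦ φ ⟧₁ H)) →
                                     IsUniformTopOp φ
isTopologicalOperator⇒uniformTopOp {φ} isTop = record
  { pres-⊤ = λ H → TermSemantics.uniform-pres-⊤ H φ (isTop H)
  ; pres-∧ = λ H → TermSemantics.uniform-pres-∧ H φ (isTop H)
  ; idem   = λ H → TermSemantics.uniform-idem H φ (isTop H)
  }

⟦⟧₁≈⇒≈ᶠ : ∀ {φ ψ} → (∀ H a → HeytingAlgebra._≈_ H (⟦ φ ⟧₁ H a) (⟦ ψ ⟧₁ H a)) → φ ≈ᶠ ψ
⟦⟧₁≈⇒≈ᶠ {φ} {ψ} φ≈ψ H = TermSemantics.⟦⟧₁≈⇒⟦⟧≈ H {φ} {ψ} (φ≈ψ H)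

isTopologicalOperator-resp-≈ᶠ : ∀ {φ ψ} → φ ≈ᶠ ψ → (∀ H → IsTopologicalOperator H (⟦ ψ ⟧₁ H)) →
                                ∀ H → IsTopologicalOperator H (⟦ φ ⟧₁ H)
isTopologicalOperator-resp-≈ᶠ {φ} {ψ} φ≈ψ isTop H =
  HeytingAlgebraProperties.isTopologicalOperator-resp-≈ H {⟦ φ ⟧₁ H} {⟦ ψ ⟧₁ H}
    (λ a → φ≈ψ H (λ _ → a)) (isTop H)

module Classification (φ : Fm 1) {H : HeytingAlgebra 0ℓ 0ℓ 0ℓ}
                      (isTop : IsTopologicalOperator H (⟦ φ ⟧₁ H)) where
  open HeytingAlgebra H renaming (refl to ≤-refl)
  open HeytingAlgebraProperties H
  open TermSemantics H
  open IsTopologicalOperator isTop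
  open import Relation.Binary.Lattice.Properties.HeytingAlgebra H using (¬_; x≤¬¬x; ⇨-eval)
  open import Relation.Binary.Lattice.Properties.MeetSemilattice meetSemilattice using (y≤x⇒x∧y≈y)
  open import Relation.Binary.Lattice.Properties.BoundedMeetSemilattice boundedMeetSemilattice
    using (identityˡ)
  open ≈-Reasoning setoid

  private
    j : Carrier → Carrier
    j = ⟦ φ ⟧₁ H

    j⊥≈ : ∀ {t} → ⟦ φ ⟧₃ (λ _ → bot) ≡ t → j ⊥ ≈ embed ⊤ ⊤ t
    j⊥≈ φ⊥ = Eq.trans (Eq.sym (identityˡ (j ⊥))) (⟦⟧₁-embed (maximum ⊤) x∧¬x≤⊥ φ φ⊥)

  jx≈⊤ : ∀ {t} → ⟦ φ ⟧₃ (λ _ → bot) ≡ t → t ≢ bot → ∀ x → j x ≈ ⊤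
  jx≈⊤ φ⊥ t≢bot = j⊥≈⊤⇒jx≈⊤ isTop (Eq.trans (j⊥≈ φ⊥) (embed-diagonal t≢bot))

  ⊤≈⊥ : ⟦ φ ⟧₃ (λ _ → mid) ≡ bot → ⊤ ≈ ⊥
  ⊤≈⊥ φ½ = begin
    ⊤        ≈⟨ Eq.sym pres-⊤ ⟩
    j ⊤      ≈⟨ Eq.sym (identityˡ (j ⊤)) ⟩
    ⊤ ∧ j ⊤  ≈⟨ ⟦⟧₁-embed (maximum ⊤) x∧¬x≤⊥ φ φ½ ⟩
    ⊥        ∎

  jx≈embed¬¬x : ∀ {t} → ⟦ φ ⟧₃ (λ _ → bot) ≡ bot → ⟦ φ ⟧₃ (λ _ → mid) ≡ t → t ≢ bot →
                ∀ x → j x ≈ embed (¬ ¬ x) x t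
  jx≈embed¬¬x {t} φ⊥ φ½ t≢bot x = begin
    j x                ≈⟨ Eq.sym (y≤x⇒x∧y≈y (jy≤¬¬y x)) ⟩
    ¬ ¬ x ∧ j x        ≈⟨ ⟦⟧₁-embed (x≤¬¬x x) ⇨-eval φ φ½ ⟩
    embed (¬ ¬ x) x t  ∎
    where
    y≤jy : ∀ y → y ≤ j y
    y≤jy y = x∧y≈x⇒x≤y (Eq.trans (⟦⟧₁-embed ≤-refl x∧¬x≤⊥ φ φ½) (embed-diagonal t≢bot))

    jy≤¬¬y : ∀ y → j y ≤ ¬ ¬ y
    jy≤¬¬y = inflationary⇒jx≤¬¬x isTop y≤jy (reflexive (j⊥≈ φ⊥))

module _ (φ : Fm 1) (isTop : ∀ H → IsTopologicalOperator H (⟦ φ ⟧₁ H)) where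
  private
    module C (H : HeytingAlgebra 0ℓ 0ℓ 0ℓ) = Classification φ (isTop H)

  topological-term-classification : (φ ≈ᶠ 𝕩) ⊎ (φ ≈ᶠ ¬ᶠ ¬ᶠ 𝕩) ⊎ (φ ≈ᶠ ⊤ᶠ)
  topological-term-classification with ⟦ φ ⟧₃ (λ _ → bot) in φ⊥ | ⟦ φ ⟧₃ (λ _ → mid) in φ½
  ... | bot | mid = inj₁ (⟦⟧₁≈⇒≈ᶠ {φ} {𝕩} λ H → C.jx≈embed¬¬x H φ⊥ φ½ λ ())
  ... | bot | top = inj₂ (inj₁ (⟦⟧₁≈⇒≈ᶠ {φ} {¬ᶠ ¬ᶠ 𝕩} λ H → C.jx≈embed¬¬x H φ⊥ φ½ λ ()))
  ... | mid | _   = inj₂ (inj₂ (⟦⟧₁≈⇒≈ᶠ {φ} {⊤ᶠ} λ H → C.jx≈⊤ H φ⊥ λ ()))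
  ... | top | _   = inj₂ (inj₂ (⟦⟧₁≈⇒≈ᶠ {φ} {⊤ᶠ} λ H → C.jx≈⊤ H φ⊥ λ ()))
  -- This case cannot occur: it would make every Heyting algebra trivial.
  ... | bot | bot = inj₂ (inj₂ (⟦⟧₁≈⇒≈ᶠ {φ} {⊤ᶠ} λ H x →
                      HeytingAlgebraProperties.⊤≈⊥⇒x≈⊤ H (C.⊤≈⊥ H φ½) (⟦ φ ⟧₁ H x)))

open HeytingAlgebraProperties
  using (id-isTopologicalOperator; ¬¬-isTopologicalOperator; const-⊤-isTopologicalOperator)
open TermSemantics using (uniformTopOp⇒isTopologicalOperator)

proposition6p4 : (φ : Fm 1) →
    (IsUniformTopOp φ → (φ ≈ᶠ 𝕩) ⊎ (φ ≈ᶠ ¬ᶠ ¬ᶠ 𝕩) ⊎ (φ ≈ᶠ ⊤ᶠ))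
    × ((φ ≈ᶠ 𝕩) ⊎ (φ ≈ᶠ ¬ᶠ ¬ᶠ 𝕩) ⊎ (φ ≈ᶠ ⊤ᶠ) → IsUniformTopOp φ)
proposition6p4 φ = only-three , each-uniform
  where
  only-three : IsUniformTopOp φ → (φ ≈ᶠ 𝕩) ⊎ (φ ≈ᶠ ¬ᶠ ¬ᶠ 𝕩) ⊎ (φ ≈ᶠ ⊤ᶠ)
  only-three U = topological-term-classification φ (λ H → uniformTopOp⇒isTopologicalOperator H U)

  each-uniform : (φ ≈ᶠ 𝕩) ⊎ (φ ≈ᶠ ¬ᶠ ¬ᶠ 𝕩) ⊎ (φ ≈ᶠ ⊤ᶠ) → IsUniformTopOp φ
  each-uniform (inj₁ φ≈x) = isTopologicalOperator⇒uniformTopOp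
    (isTopologicalOperator-resp-≈ᶠ {φ} {𝕩} φ≈x id-isTopologicalOperator)
  each-uniform (inj₂ (inj₁ φ≈¬¬x)) = isTopologicalOperator⇒uniformTopOp
    (isTopologicalOperator-resp-≈ᶠ {φ} {¬ᶠ ¬ᶠ 𝕩} φ≈¬¬x ¬¬-isTopologicalOperator)
  each-uniform (inj₂ (inj₂ φ≈⊤)) = isTopologicalOperator⇒uniformTopOp
    (isTopologicalOperator-resp-≈ᶠ {φ} {⊤ᶠ} φ≈⊤ const-⊤-isTopologicalOperator)
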